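{- Let $a_1<a_2<a_3$ be positive integers with $\gcd(a_1,a_2)=1$, let $b$ be a nonnegative integer, and let $$T(a_1,a_2,a_3,b)=\{(x_1,x_2,x_3)\in\mathbb{R}^3 \;|\; x_i\geq 0,\ a_1x_1+a_2x_2+a_3x_3\leq b\}.$$ For $i=0,\dots,\lfloor b/a_3\rfloor$ define $q_i,r_i$ by the Euclidean division $b-a_3 i=q_i(a_1a_2)+r_i$ with $0\le r_i<a_1a_2$. Then $$\#\left(T(a_1,a_2,a_3,b)\cap\mathbb{Z}^3\right)=\sum_{i=0}^{\lfloor b/a_3\rfloor}\left(-\frac{a_1a_2}{2}q_i^2+\frac{a_1+a_2+1+2(b-a_3 i)}{2}q_i+\sum_{j=0}^{\lfloor r_i/a_2\rfloor}\left(\left\lfloor\frac{r_i-ja_2}{a_1}\right\rfloor+1\right)\right).$$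
   Context: $\lfloor\cdot\rfloor$ denotes the floor function and $\#$ denotes cardinality. -}

module Defs where

open import Data.Nat as ℕ using (ℕ; zero; suc; _≤_; NonZero)
open import Data.Nat.DivMod using (_/_; _%_)
open import Data.Nat.Properties using (m*n≢0)
open import Data.Product using (Σ; _×_; _,_)
open import Data.Integer using (+_)
open import Data.Rational as ℚ using (ℚ)

LatticePts : ℕ → ℕ → ℕ → ℕ → Set
LatticePts a1 a2 a3 b =
  Σ (ℕ × ℕ × ℕ) λ { (x1 , x2 , x3) → a1 ℕ.* x1 ℕ.+ a2 ℕ.* x2 ℕ.+ a3 ℕ.* x3 ≤ b }

ℕ→ℚ : ℕ → ℚ
ℕ→ℚ n = (+ n) ℚ./ 1

sumℕ : ℕ → (ℕ → ℕ) → ℕ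
sumℕ zero f = f 0
sumℕ (suc n) f = sumℕ n f ℕ.+ f (suc n)

sumℚ : ℕ → (ℕ → ℚ) → ℚ
sumℚ zero f = f 0
sumℚ (suc n) f = sumℚ n f ℚ.+ f (suc n)

-- q_i and r_i : b - a3 i = q_i (a1 a2) + r_i, 0 ≤ r_i < a1 a2
-- (b - a3 i ≥ 0 for i ≤ ⌊b/a3⌋, so truncated subtraction is exact)
qDiv : (a1 a2 a3 b i : ℕ) → .{{NonZero a1}} → .{{NonZero a2}} → ℕ
qDiv a1 a2 a3 b i = (b ℕ.∸ a3 ℕ.* i) / (a1 ℕ.* a2)
  where instance _ = m*n≢0 a1 a2

rRem : (a1 a2 a3 b i : ℕ) → .{{NonZero a1}} → .{{NonZero a2}} → ℕ
rRem a1 a2 a3 b i = (b ℕ.∸ a3 ℕ.* i) % (a1 ℕ.* a2)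
  where instance _ = m*n≢0 a1 a2

term : (a1 a2 a3 b i : ℕ) → .{{NonZero a1}} → .{{NonZero a2}} → ℚ
term a1 a2 a3 b i =
  (ℚ.- ((+ (a1 ℕ.* a2)) ℚ./ 2)) ℚ.* (q ℚ.* q)
  ℚ.+ ((+ (a1 ℕ.+ a2 ℕ.+ 1 ℕ.+ 2 ℕ.* (b ℕ.∸ a3 ℕ.* i))) ℚ./ 2) ℚ.* q
  ℚ.+ ℕ→ℚ (sumℕ (r / a2) (λ j → (r ℕ.∸ j ℕ.* a2) / a1 ℕ.+ 1))
  where
    q = ℕ→ℚ (qDiv a1 a2 a3 b i)
    r = rRem a1 a2 a3 b i

countFormula : (a1 a2 a3 b : ℕ) → .{{NonZero a1}} → .{{NonZero a2}} → .{{NonZero a3}} → ℚ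
countFormula a1 a2 a3 b = sumℚ (b / a3) (λ i → term a1 a2 a3 b i)

-- Slicing by x3 reduces the count to F(c) = #{(x1, x2) ∈ ℕ² | a1 x1 + a2 x2 ≤ c} with
-- c = b - a3 x3, and counting by x2 gives F(c) = Σ_{j ≤ c/a2} (⌊(c - j a2)/a1⌋ + 1).
-- Writing c = r + q a1 a2, the summand of the theorem is F(c) as soon as
-- 2 F(c + a1 a2) = 2 F(c) + 2c + a1 a2 + a1 + a2 + 1.  Passing from c to c + a1 a2 adds
-- a1 rows x2 < a1, and after reversing them they contribute a1 + h(c + a2), where
-- h(d) = Σ_{t < a1} ⌊(d + t a2)/a1⌋.  As a2 is invertible modulo a1, exactly one t < a1
-- makes d + 1 + t a2 divisible by a1, so h(d + 1) = h(d) + 1; pairing t with a1 - 1 - t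
-- gives h(0) + h(a2 - 1) + a1 = a1 a2.  Together, 2 h(d) = (a1 - 1)(a2 - 1) + 2d.

module Submission where

open import Defs
open import Data.Nat using (ℕ; zero; suc; _+_; _*_; _∸_; _≤_; _<_; pred; z≤n; s≤s; z<s; NonZero)
open import Data.Nat.Properties
open import Data.Nat.DivMod
open import Data.Nat.Divisibility using (_∣_; divides; ∣m+n∣m⇒∣n; n∣m⇒m%n≡0; m%n≡0⇒n∣m; >⇒∤; ∣1⇒≡1)
open import Data.Nat.Coprimality using (Coprime; coprime-Bézout; coprime-divisor)
open import Data.Nat.GCD using (module Bézout)
open import Data.Nat.Solver using (module +-*-Solver)
open +-*-Solver using (solve; _:+_; _:*_; _:=_; con)
import Data.Integer as ℤ
import Data.Integer.Properties as ℤ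
open import Data.Rational as ℚ using (ℚ; mkℚ; ½)
open import Data.Rational.Properties using (normalize-coprime)
import Data.Rational.Solver
open import Data.Fin using (Fin; toℕ; fromℕ<)
open import Data.Fin.Properties using (+↔⊎; toℕ≤pred[n]; toℕ-fromℕ<; fromℕ<-toℕ)
open import Data.Product using (Σ; _×_; ∃-syntax; _,_)
open import Data.Sum using (_⊎_; inj₁; inj₂)
open import Data.Sum.Function.Propositional using (_⊎-↔_)
open import Function.Bundles using (_↔_; mk↔ₛ′)
open import Function.Properties.Inverse using (↔-trans)
open import Relation.Nullary using (yes; no)
open import Relation.Nullary.Negation using (contradiction)
open import Relation.Binary.PropositionalEquality

module ℚ-Ring = Data.Rational.Solver.+-*-Solver

∑< : ℕ → (ℕ → ℕ) → ℕ
∑< zero    f = 0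
∑< (suc n) f = ∑< n f + f n

sumℕ≡∑< : ∀ n f → sumℕ n f ≡ ∑< (suc n) f
sumℕ≡∑< zero    f = refl
sumℕ≡∑< (suc n) f = cong (_+ f (suc n)) (sumℕ≡∑< n f)

∑<-cong : ∀ n {f g} → (∀ t → t < n → f t ≡ g t) → ∑< n f ≡ ∑< n g
∑<-cong zero    f≗g = refl
∑<-cong (suc n) f≗g = cong₂ _+_ (∑<-cong n (λ t t<n → f≗g t (m<n⇒m<1+n t<n))) (f≗g n ≤-refl)

∑<-distrib-+ : ∀ n f g → ∑< n (λ t → f t + g t) ≡ ∑< n f + ∑< n g
∑<-distrib-+ zero    f g = refl
∑<-distrib-+ (suc n) f g rewrite ∑<-distrib-+ n f g = +-exchange (∑< n f) (∑< n g) (f n) (g n)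
  where
  +-exchange : ∀ a b c d → a + b + (c + d) ≡ a + c + (b + d)
  +-exchange = solve 4 (λ a b c d → a :+ b :+ (c :+ d) := a :+ c :+ (b :+ d)) refl

∑<-const : ∀ n k → ∑< n (λ _ → k) ≡ n * k
∑<-const zero    k = refl
∑<-const (suc n) k = trans (cong (_+ k) (∑<-const n k)) (+-comm (n * k) k)

∑<-suc : ∀ n f → ∑< (suc n) f ≡ f 0 + ∑< n (λ t → f (suc t))
∑<-suc zero    f = +-comm 0 (f 0)
∑<-suc (suc n) f = trans (cong (_+ f (suc n)) (∑<-suc n f)) (+-assoc (f 0) _ _)

∑<-+ : ∀ k n f → ∑< (k + n) f ≡ ∑< k f + ∑< n (λ t → f (k + t))
∑<-+ k zero    f = trans (cong (λ z → ∑< z f) (+-identityʳ k)) (sym (+-identityʳ _))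
∑<-+ k (suc n) f rewrite +-suc k n | ∑<-+ k n f = +-assoc (∑< k f) _ _

∑<-reverse : ∀ n f → ∑< n f ≡ ∑< n (λ t → f (n ∸ suc t))
∑<-reverse zero    f = refl
∑<-reverse (suc n) f = begin
  ∑< n f + f n                          ≡⟨ cong (_+ f n) (∑<-reverse n f) ⟩
  ∑< n (λ t → f (n ∸ suc t)) + f n      ≡⟨ +-comm _ (f n) ⟩
  f n + ∑< n (λ t → f (n ∸ suc t))      ≡⟨ ∑<-suc n (λ t → f (n ∸ t)) ⟨
  ∑< (suc n) (λ t → f (n ∸ t))          ∎
  where open ≡-Reasoning

∑<-single : ∀ n f {t₀} → t₀ < n → (∀ t → t < n → t ≢ t₀ → f t ≡ 0) → ∑< n f ≡ f t₀
∑<-single (suc n) f {t₀} t₀<1+n vanish with t₀ ≟ n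
... | yes refl = cong (_+ f n) (trans (∑<-cong n (λ t t<n → vanish t (m<n⇒m<1+n t<n) (<⇒≢ t<n)))
                                      (trans (∑<-const n 0) (*-zeroʳ n)))
... | no t₀≢n = begin
  ∑< n f + f n ≡⟨ cong₂ _+_ (∑<-single n f (≤∧≢⇒< (≤-pred t₀<1+n) t₀≢n) (λ t t<n → vanish t (m<n⇒m<1+n t<n)))
                            (vanish n ≤-refl (≢-sym t₀≢n)) ⟩
  f t₀ + 0     ≡⟨ +-identityʳ (f t₀) ⟩
  f t₀         ∎
  where open ≡-Reasoning

[r+q*n]/n≡q : ∀ {r} q n .{{_ : NonZero n}} → r < n → (r + q * n) / n ≡ q
[r+q*n]/n≡q {r} q n r<n = trans (+-distrib-/-∣ʳ r (divides q refl)) (cong₂ _+_ (m<n⇒m/n≡0 r<n) (m*n/n≡m q n))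

[r+q*n]%n≡r : ∀ {r} q n .{{_ : NonZero n}} → r < n → (r + q * n) % n ≡ r
[r+q*n]%n≡r {r} q n r<n = trans ([m+kn]%n≡m%n r q n) (m<n⇒m%n≡m r<n)

δ₀ : ℕ → ℕ
δ₀ zero    = 1
δ₀ (suc _) = 0

δ₀-≢0 : ∀ {k} → k ≢ 0 → δ₀ k ≡ 0
δ₀-≢0 {zero}  k≢0 = contradiction refl k≢0
δ₀-≢0 {suc k} _   = refl

1+m/n≡m/n+δ₀[1+m%n] : ∀ m n .{{_ : NonZero n}} → suc m / n ≡ m / n + δ₀ (suc m % n)
1+m/n≡m/n+δ₀[1+m%n] m n with m % n | m / n | m≡m%n+[m/n]*n m n | m%n<n m n
... | r | q | m≡r+q*n | r<n with suc r ≟ n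
...   | no 1+r≢n = begin
  suc m / n               ≡⟨ cong (_/ n) 1+m≡ ⟩
  (suc r + q * n) / n     ≡⟨ [r+q*n]/n≡q q n 1+r<n ⟩
  q                       ≡⟨ +-identityʳ q ⟨
  q + δ₀ (suc r)          ≡⟨ cong (λ k → q + δ₀ k) (trans (cong (_% n) 1+m≡) ([r+q*n]%n≡r q n 1+r<n)) ⟨
  q + δ₀ (suc m % n)      ∎
  where
  open ≡-Reasoning
  1+m≡ : suc m ≡ suc r + q * n
  1+m≡ = cong suc m≡r+q*n
  1+r<n : suc r < n
  1+r<n = ≤∧≢⇒< r<n 1+r≢n
...   | yes 1+r≡n = begin
  suc m / n               ≡⟨ cong (_/ n) 1+m≡ ⟩
  (0 + suc q * n) / n     ≡⟨ [r+q*n]/n≡q (suc q) n 0<n ⟩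
  suc q                   ≡⟨ +-comm 1 q ⟩
  q + δ₀ 0                ≡⟨ cong (λ k → q + δ₀ k) (trans (cong (_% n) 1+m≡) ([r+q*n]%n≡r (suc q) n 0<n)) ⟨
  q + δ₀ (suc m % n)      ∎
  where
  open ≡-Reasoning
  1+m≡ : suc m ≡ 0 + suc q * n
  1+m≡ = trans (cong suc m≡r+q*n) (cong (_+ q * n) 1+r≡n)
  0<n : 0 < n
  0<n = subst (0 <_) 1+r≡n z<s

n∣m∧0<m<n+n⇒m≡n : ∀ {m n} → n ∣ m → 0 < m → m < n + n → m ≡ n
n∣m∧0<m<n+n⇒m≡n {n = n} (divides (suc zero)     refl) _ _     = +-identityʳ n
n∣m∧0<m<n+n⇒m≡n {n = n} (divides (suc (suc c)) refl) _ m<n+n =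
  contradiction m<n+n (≤⇒≯ (+-monoʳ-≤ n (m≤m+n n (c * n))))

x+y+1≡k*n⇒x/n+y/n+1≡k : ∀ x y k n .{{_ : NonZero n}} → x + y + 1 ≡ k * n → x / n + y / n + 1 ≡ k
x+y+1≡k*n⇒x/n+y/n+1≡k x y k n x+y+1≡k*n
  with x % n | x / n | m≡m%n+[m/n]*n x n | m%n<n x n | y % n | y / n | m≡m%n+[m/n]*n y n | m%n<n y n
... | xr | xq | refl | xr<n | yr | yq | refl | yr<n = *-cancelʳ-≡ (xq + yq + 1) k n (begin
  (xq + yq + 1) * n                  ≡⟨ rearrange xq yq n ⟩
  n + (xq + yq) * n                  ≡⟨ cong (_+ (xq + yq) * n) carry ⟨
  (xr + yr + 1) + (xq + yq) * n      ≡⟨ split ⟩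
  k * n                              ∎)
  where
  open ≡-Reasoning
  rearrange : ∀ a b n → (a + b + 1) * n ≡ n + (a + b) * n
  rearrange = solve 3 (λ a b n → (a :+ b :+ con 1) :* n := n :+ (a :+ b) :* n) refl
  split : (xr + yr + 1) + (xq + yq) * n ≡ k * n
  split = trans (regroup xr yr xq yq n) x+y+1≡k*n
    where
    regroup : ∀ xr yr xq yq n → (xr + yr + 1) + (xq + yq) * n ≡ xr + xq * n + (yr + yq * n) + 1
    regroup = solve 5 (λ xr yr xq yq n → (xr :+ yr :+ con 1) :+ (xq :+ yq) :* n := xr :+ xq :* n :+ (yr :+ yq :* n) :+ con 1) refl
  carry : xr + yr + 1 ≡ n
  carry = n∣m∧0<m<n+n⇒m≡n
    (∣m+n∣m⇒∣n (subst (n ∣_) (trans (sym split) (+-comm _ ((xq + yq) * n))) (divides k refl)) (divides (xq + yq) refl))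
    (subst (0 <_) (+-comm 1 (xr + yr)) z<s)
    (subst (_≤ n + n) (cong suc (trans (+-suc xr yr) (+-comm 1 (xr + yr)))) (+-mono-≤ xr<n yr<n))

Fin[1+k]↔≤k : ∀ k → Fin (suc k) ↔ Σ ℕ (_≤ k)
Fin[1+k]↔≤k k = mk↔ₛ′ to from (λ (x , x≤k) → ≤k-≡ (toℕ-fromℕ< (s≤s x≤k))) (λ i → fromℕ<-toℕ i _)
  where
  to : Fin (suc k) → Σ ℕ (_≤ k)
  to i = toℕ i , toℕ≤pred[n] i
  from : Σ ℕ (_≤ k) → Fin (suc k)
  from (x , x≤k) = fromℕ< (s≤s x≤k)
  ≤k-≡ : ∀ {x y} {x≤k : x ≤ k} {y≤k : y ≤ k} → x ≡ y → (x , x≤k) ≡ (y , y≤k)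
  ≤k-≡ refl = cong (_ ,_) (≤-irrelevant _ _)

Fin[k+1]↔≤k : ∀ k → Fin (k + 1) ↔ Σ ℕ (_≤ k)
Fin[k+1]↔≤k k = subst (λ n → Fin n ↔ Σ ℕ (_≤ k)) (+-comm 1 k) (Fin[1+k]↔≤k k)

module _ (A : ℕ → Set) where

  Σ≤0↔ : A 0 ↔ Σ ℕ (λ i → i ≤ 0 × A i)
  Σ≤0↔ = mk↔ₛ′ (λ a → 0 , z≤n , a) (λ { (.0 , z≤n , a) → a }) (λ { (.0 , z≤n , a) → refl }) (λ _ → refl)

  Σ≤suc↔ : ∀ n → (Σ ℕ (λ i → i ≤ n × A i) ⊎ A (suc n)) ↔ Σ ℕ (λ i → i ≤ suc n × A i)
  Σ≤suc↔ n = mk↔ₛ′ to from to∘from from∘to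
    where
    to : Σ ℕ (λ i → i ≤ n × A i) ⊎ A (suc n) → Σ ℕ (λ i → i ≤ suc n × A i)
    to (inj₁ (i , i≤n , a)) = i , m≤n⇒m≤1+n i≤n , a
    to (inj₂ a)             = suc n , ≤-refl , a
    from : Σ ℕ (λ i → i ≤ suc n × A i) → Σ ℕ (λ i → i ≤ n × A i) ⊎ A (suc n)
    from (i , i≤1+n , a) with i ≤? n
    ... | yes i≤n = inj₁ (i , i≤n , a)
    ... | no  i≰n = inj₂ (subst A (≤-antisym i≤1+n (≰⇒> i≰n)) a)
    to-top : ∀ {i} (i≡1+n : i ≡ suc n) (i≤1+n : i ≤ suc n) (a : A i) → (suc n , ≤-refl , subst A i≡1+n a) ≡ (i , i≤1+n , a)
    to-top refl i≤1+n a = cong (λ p → suc n , p , a) (≤-irrelevant _ _)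
    to∘from : ∀ y → to (from y) ≡ y
    to∘from (i , i≤1+n , a) with i ≤? n
    ... | yes i≤n = cong (λ p → i , p , a) (≤-irrelevant _ _)
    ... | no  i≰n = to-top (≤-antisym i≤1+n (≰⇒> i≰n)) i≤1+n a
    from∘to : ∀ x → from (to x) ≡ x
    from∘to (inj₁ (i , i≤n , a)) with i ≤? n
    ... | yes i≤n′ = cong (λ p → inj₁ (i , p , a)) (≤-irrelevant _ _)
    ... | no  i≰n  = contradiction i≤n i≰n
    from∘to (inj₂ a) with suc n ≤? n
    ... | yes 1+n≤n = contradiction 1+n≤n (n≮n n)
    ... | no  1+n≰n = cong (λ e → inj₂ (subst A e a)) (≡-irrelevant _ refl)

  Fin-sumℕ↔Σ≤ : (f : ℕ → ℕ) → (∀ i → Fin (f i) ↔ A i) → ∀ n → Fin (sumℕ n f) ↔ Σ ℕ (λ i → i ≤ n × A i)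
  Fin-sumℕ↔Σ≤ f Fin↔A zero    = ↔-trans (Fin↔A 0) Σ≤0↔
  Fin-sumℕ↔Σ≤ f Fin↔A (suc n) = ↔-trans +↔⊎ (↔-trans (Fin-sumℕ↔Σ≤ f Fin↔A n ⊎-↔ Fin↔A (suc n)) (Σ≤suc↔ n))

m≤n/o⇒m*o≤n : ∀ {m n} o .{{_ : NonZero o}} → m ≤ n / o → m * o ≤ n
m≤n/o⇒m*o≤n {n = n} o m≤n/o = ≤-trans (*-monoˡ-≤ o m≤n/o) (m/n*n≤m n o)

m*o≤n⇒m≤n/o : ∀ {m n} o .{{_ : NonZero o}} → m * o ≤ n → m ≤ n / o
m*o≤n⇒m≤n/o {m} {n} o m*o≤n = subst (_≤ n / o) (m*n/n≡m m o) (/-monoˡ-≤ o m*o≤n)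


module _ (a1 a2 : ℕ) .{{_ : NonZero a1}} .{{_ : NonZero a2}} where

  count₂ : ℕ → ℕ
  count₂ c = sumℕ (c / a2) (λ j → (c ∸ j * a2) / a1 + 1)

  Pts₂ : ℕ → Set
  Pts₂ c = Σ ℕ (λ x2 → x2 ≤ c / a2 × Σ ℕ (_≤ (c ∸ x2 * a2) / a1))

  Fin-count₂↔Pts₂ : ∀ c → Fin (count₂ c) ↔ Pts₂ c
  Fin-count₂↔Pts₂ c = Fin-sumℕ↔Σ≤ (λ x2 → Σ ℕ (_≤ (c ∸ x2 * a2) / a1)) _ (λ _ → Fin[k+1]↔≤k _) (c / a2)

  floorSum : ℕ → ℕ
  floorSum d = ∑< a1 (λ t → (d + t * a2) / a1)

  floorSum-complement : ∀ d d' → suc (d + d') ≡ a2 → floorSum d + floorSum d' + a1 ≡ a1 * a2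
  floorSum-complement d d' 1+d+d'≡a2 = begin
    floorSum d + floorSum d' + a1
      ≡⟨ cong₂ (λ x y → floorSum d + x + y) (∑<-reverse a1 _) (sym (trans (∑<-const a1 1) (*-identityʳ a1))) ⟩
    ∑< a1 f + ∑< a1 f' + ∑< a1 (λ _ → 1)
      ≡⟨ trans (∑<-distrib-+ a1 (λ t → f t + f' t) (λ _ → 1)) (cong (_+ ∑< a1 (λ _ → 1)) (∑<-distrib-+ a1 f f')) ⟨
    ∑< a1 (λ t → f t + f' t + 1)
      ≡⟨ ∑<-cong a1 (λ t t<a1 → x+y+1≡k*n⇒x/n+y/n+1≡k _ _ a2 a1 (pairs-up t<a1)) ⟩
    ∑< a1 (λ _ → a2)
      ≡⟨ ∑<-const a1 a2 ⟩
    a1 * a2 ∎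
    where
    open ≡-Reasoning
    f f' : ℕ → ℕ
    f t = (d + t * a2) / a1
    f' t = (d' + (a1 ∸ suc t) * a2) / a1
    pairs-up : ∀ {t} → t < a1 → d + t * a2 + (d' + (a1 ∸ suc t) * a2) + 1 ≡ a2 * a1
    pairs-up {t} t<a1 with m≤n⇒∃[o]m+o≡n t<a1
    ... | s , 1+t+s≡a1 = subst₂ (λ A1 A2 → d + t * A2 + (d' + (A1 ∸ suc t) * A2) + 1 ≡ A2 * A1)
                                1+t+s≡a1 1+d+d'≡a2 (identity t s)
      where
      identity : ∀ t s → d + t * suc (d + d') + (d' + (suc t + s ∸ suc t) * suc (d + d')) + 1 ≡ suc (d + d') * (suc t + s)
      identity t s rewrite m+n∸m≡n (suc t) s = ring d d' t s
        where
        ring : ∀ d d' t s → d + t * suc (d + d') + (d' + s * suc (d + d')) + 1 ≡ suc (d + d') * (suc t + s)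
        ring = solve 4 (λ d d' t s → d :+ t :* (con 1 :+ (d :+ d')) :+ (d' :+ s :* (con 1 :+ (d :+ d'))) :+ con 1
            := (con 1 :+ (d :+ d')) :* ((con 1 :+ t) :+ s)) refl

  count₂-+ : ∀ c → count₂ (c + a1 * a2) ≡ floorSum (c + a2) + a1 + count₂ c
  count₂-+ c = begin
    count₂ (c + m)
      ≡⟨ sumℕ≡∑< ((c + m) / a2) g ⟩
    ∑< (suc ((c + m) / a2)) g
      ≡⟨ cong (λ n → ∑< n g) length ⟩
    ∑< (a1 + suc (c / a2)) g
      ≡⟨ ∑<-+ a1 (suc (c / a2)) g ⟩
    ∑< a1 g + ∑< (suc (c / a2)) (λ t → g (a1 + t))
      ≡⟨ cong₂ _+_ (trans (∑<-reverse a1 g) (∑<-cong a1 (λ _ → low-rows)))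
                   (∑<-cong (suc (c / a2)) (λ _ _ → cong (λ k → k / a1 + 1) high-rows)) ⟩
    ∑< a1 (λ t → (c + a2 + t * a2) / a1 + 1) + ∑< (suc (c / a2)) (λ t → (c ∸ t * a2) / a1 + 1)
      ≡⟨ cong₂ _+_ (trans (∑<-distrib-+ a1 _ (λ _ → 1)) (cong (floorSum (c + a2) +_) (trans (∑<-const a1 1) (*-identityʳ a1))))
                   (sym (sumℕ≡∑< (c / a2) _)) ⟩
    floorSum (c + a2) + a1 + count₂ c ∎
    where
    open ≡-Reasoning
    m : ℕ
    m = a1 * a2
    g : ℕ → ℕ
    g j = (c + m ∸ j * a2) / a1 + 1
    length : suc ((c + m) / a2) ≡ a1 + suc (c / a2)
    length = begin
      suc ((c + m) / a2)        ≡⟨ cong suc (+-distrib-/-∣ʳ c (divides a1 refl)) ⟩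
      suc (c / a2 + m / a2)     ≡⟨ cong (λ k → suc (c / a2 + k)) (m*n/n≡m a1 a2) ⟩
      suc (c / a2 + a1)         ≡⟨ cong suc (+-comm (c / a2) a1) ⟩
      suc (a1 + c / a2)         ≡⟨ +-suc a1 (c / a2) ⟨
      a1 + suc (c / a2)         ∎
    high-rows : ∀ {t} → c + m ∸ (a1 + t) * a2 ≡ c ∸ t * a2
    high-rows {t} = begin
      c + m ∸ (a1 + t) * a2     ≡⟨ cong₂ _∸_ (+-comm c m) (*-distribʳ-+ a2 a1 t) ⟩
      m + c ∸ (m + t * a2)      ≡⟨ [m+n]∸[m+o]≡n∸o m c (t * a2) ⟩
      c ∸ t * a2                ∎
    low-rows : ∀ {t} → t < a1 → g (a1 ∸ suc t) ≡ (c + a2 + t * a2) / a1 + 1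
    low-rows {t} t<a1 with m≤n⇒∃[o]m+o≡n t<a1
    ... | s , 1+t+s≡a1 = cong (λ k → k / a1 + 1) (subst (λ A1 → c + A1 * a2 ∸ (A1 ∸ suc t) * a2 ≡ c + a2 + t * a2) 1+t+s≡a1 rows)
      where
      rows : c + (suc t + s) * a2 ∸ (suc t + s ∸ suc t) * a2 ≡ c + a2 + t * a2
      rows rewrite m+n∸m≡n (suc t) s = trans (cong (_∸ s * a2) (ring c t s a2)) (m+n∸n≡m (c + a2 + t * a2) (s * a2))
        where
        ring : ∀ c t s a2 → c + (suc t + s) * a2 ≡ c + a2 + t * a2 + s * a2
        ring = solve 4 (λ c t s a2 → c :+ ((con 1 :+ t) :+ s) :* a2 := c :+ a2 :+ t :* a2 :+ s :* a2) refl

  module _ (coprime : Coprime a1 a2) where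

    ∃-multiplier : ∀ e → ∃[ T ] a1 ∣ e + T * a2
    ∃-multiplier e with coprime-Bézout coprime
    ... | Bézout.+- x y 1+y*a2≡x*a1 = e * y , divides (e * x) (begin
      e + e * y * a2     ≡⟨ ring e y a2 ⟩
      e * (1 + y * a2)   ≡⟨ cong (e *_) 1+y*a2≡x*a1 ⟩
      e * (x * a1)       ≡⟨ *-assoc e x a1 ⟨
      e * x * a1         ∎)
      where
      open ≡-Reasoning
      ring : ∀ e y a2 → e + e * y * a2 ≡ e * (1 + y * a2)
      ring = solve 3 (λ e y a2 → e :+ e :* y :* a2 := e :* (con 1 :+ y :* a2)) refl
    -- Here y a2 ≡ 1 (mod a1), so T = (a1 - 1) e y gives e + T a2 ≡ a1 e ≡ 0.
    ... | Bézout.-+ x y 1+x*a1≡y*a2 = e * pred a1 * y , divides (e + e * pred a1 * x) (begin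
      e + e * p * y * a2              ≡⟨ cong (e +_) (*-assoc (e * p) y a2) ⟩
      e + e * p * (y * a2)            ≡⟨ cong (λ k → e + e * p * k) 1+x*a1≡y*a2 ⟨
      e + e * p * (1 + x * a1)        ≡⟨ cong (λ A1 → e + e * p * (1 + x * A1)) (suc-pred a1) ⟨
      e + e * p * (1 + x * suc p)     ≡⟨ ring e p x ⟩
      (e + e * p * x) * suc p         ≡⟨ cong ((e + e * p * x) *_) (suc-pred a1) ⟩
      (e + e * p * x) * a1            ∎)
      where
      open ≡-Reasoning
      p : ℕ
      p = pred a1
      ring : ∀ e p x → e + e * p * (1 + x * suc p) ≡ (e + e * p * x) * suc p
      ring = solve 3 (λ e p x → e :+ e :* p :* (con 1 :+ x :* (con 1 :+ p)) := (e :+ e :* p :* x) :* (con 1 :+ p)) refl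

    solution-exists : ∀ e → ∃[ t ] t < a1 × a1 ∣ e + t * a2
    solution-exists e with ∃-multiplier e
    ... | T , a1∣e+T*a2 = T % a1 , m%n<n T a1 ,
      ∣m+n∣m⇒∣n (subst (a1 ∣_) split a1∣e+T*a2) (divides (T / a1 * a2) refl)
      where
      ring : ∀ e r q a1 a2 → e + (r + q * a1) * a2 ≡ q * a2 * a1 + (e + r * a2)
      ring = solve 5 (λ e r q a1 a2 → e :+ (r :+ q :* a1) :* a2 := q :* a2 :* a1 :+ (e :+ r :* a2)) refl
      split : e + T * a2 ≡ T / a1 * a2 * a1 + (e + T % a1 * a2)
      split = trans (cong (λ k → e + k * a2) (m≡m%n+[m/n]*n T a1)) (ring e (T % a1) (T / a1) a1 a2)

    solution-unique-≤ : ∀ {e t t'} → t ≤ t' → t' < a1 → a1 ∣ e + t * a2 → a1 ∣ e + t' * a2 → t ≡ t'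
    solution-unique-≤ {e} {t} t≤t' t'<a1 a1∣e+t*a2 a1∣e+t'*a2 with m≤n⇒∃[o]m+o≡n t≤t'
    ... | zero  , refl = sym (+-identityʳ t)
    ... | suc d , refl = contradiction (coprime-divisor coprime a1∣a2*[1+d]) (>⇒∤ (≤-<-trans (m≤n+m (suc d) t) t'<a1))
      where
      ring : ∀ e t d a2 → e + (t + d) * a2 ≡ e + t * a2 + a2 * d
      ring = solve 4 (λ e t d a2 → e :+ (t :+ d) :* a2 := e :+ t :* a2 :+ a2 :* d) refl
      a1∣a2*[1+d] : a1 ∣ a2 * suc d
      a1∣a2*[1+d] = ∣m+n∣m⇒∣n (subst (a1 ∣_) (ring e t (suc d) a2) a1∣e+t'*a2) a1∣e+t*a2

    solution-unique : ∀ {e t t'} → t < a1 → t' < a1 → a1 ∣ e + t * a2 → a1 ∣ e + t' * a2 → t ≡ t'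
    solution-unique {t = t} {t'} t<a1 t'<a1 sol sol' with ≤-total t t'
    ... | inj₁ t≤t' = solution-unique-≤ t≤t' t'<a1 sol sol'
    ... | inj₂ t'≤t = sym (solution-unique-≤ t'≤t t<a1 sol' sol)

    floorSum-suc : ∀ d → floorSum (suc d) ≡ floorSum d + 1
    floorSum-suc d = let t₀ , t₀<a1 , a1∣1+d+t₀*a2 = solution-exists (suc d) in begin
      floorSum (suc d)
        ≡⟨ ∑<-cong a1 (λ t _ → 1+m/n≡m/n+δ₀[1+m%n] (d + t * a2) a1) ⟩
      ∑< a1 (λ t → (d + t * a2) / a1 + carry t)
        ≡⟨ ∑<-distrib-+ a1 (λ t → (d + t * a2) / a1) carry ⟩
      floorSum d + ∑< a1 carry
        ≡⟨ cong (floorSum d +_) (∑<-single a1 carry t₀<a1 (no-carry t₀<a1 a1∣1+d+t₀*a2)) ⟩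
      floorSum d + carry t₀
        ≡⟨ cong (λ k → floorSum d + δ₀ k) (n∣m⇒m%n≡0 (suc d + t₀ * a2) a1 a1∣1+d+t₀*a2) ⟩
      floorSum d + 1 ∎
      where
      open ≡-Reasoning
      carry : ℕ → ℕ
      carry t = δ₀ (suc (d + t * a2) % a1)
      no-carry : ∀ {t₀} → t₀ < a1 → a1 ∣ suc d + t₀ * a2 → ∀ t → t < a1 → t ≢ t₀ → carry t ≡ 0
      no-carry t₀<a1 sol₀ t t<a1 t≢t₀ =
        δ₀-≢0 (λ r≡0 → t≢t₀ (solution-unique t<a1 t₀<a1 (m%n≡0⇒n∣m (suc d + t * a2) a1 r≡0) sol₀))

    floorSum-+ : ∀ d → floorSum d ≡ floorSum 0 + d
    floorSum-+ zero    = sym (+-identityʳ (floorSum 0))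
    floorSum-+ (suc d) = begin
      floorSum (suc d)     ≡⟨ floorSum-suc d ⟩
      floorSum d + 1       ≡⟨ cong (_+ 1) (floorSum-+ d) ⟩
      floorSum 0 + d + 1   ≡⟨ +-assoc (floorSum 0) d 1 ⟩
      floorSum 0 + (d + 1) ≡⟨ cong (floorSum 0 +_) (+-comm d 1) ⟩
      floorSum 0 + suc d   ∎
      where open ≡-Reasoning

    floorSum-closed-form : ∀ d → 2 * floorSum d + a1 + a2 ≡ a1 * a2 + 2 * d + 1
    floorSum-closed-form d = begin
      2 * floorSum d + a1 + a2               ≡⟨ cong₂ (λ h A2 → 2 * h + a1 + A2) (floorSum-+ d) (sym (suc-pred a2)) ⟩
      2 * (h₀ + d) + a1 + suc p              ≡⟨ ring h₀ d a1 p ⟩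
      h₀ + (h₀ + p) + a1 + 2 * d + 1         ≡⟨ cong (λ h → h₀ + h + a1 + 2 * d + 1) (floorSum-+ p) ⟨
      h₀ + floorSum p + a1 + 2 * d + 1       ≡⟨ cong (λ k → k + 2 * d + 1) (floorSum-complement 0 p (suc-pred a2)) ⟩
      a1 * a2 + 2 * d + 1                    ∎
      where
      open ≡-Reasoning
      h₀ p : ℕ
      h₀ = floorSum 0
      p = pred a2
      ring : ∀ h₀ d a1 p → 2 * (h₀ + d) + a1 + suc p ≡ h₀ + (h₀ + p) + a1 + 2 * d + 1
      ring = solve 4 (λ h₀ d a1 p → con 2 :* (h₀ :+ d) :+ a1 :+ (con 1 :+ p) := h₀ :+ (h₀ :+ p) :+ a1 :+ con 2 :* d :+ con 1) refl

    double-count₂-+ : ∀ c → 2 * count₂ (c + a1 * a2) ≡ 2 * count₂ c + 2 * c + a1 * a2 + a1 + a2 + 1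
    double-count₂-+ c = +-cancelʳ-≡ (a1 + a2) _ _ (begin
      2 * count₂ (c + a1 * a2) + (a1 + a2)
        ≡⟨ cong (λ k → 2 * k + (a1 + a2)) (count₂-+ c) ⟩
      2 * (h + a1 + F) + (a1 + a2)
        ≡⟨ ring₁ h a1 a2 F ⟩
      (2 * h + a1 + a2) + 2 * a1 + 2 * F
        ≡⟨ cong (λ k → k + 2 * a1 + 2 * F) (floorSum-closed-form (c + a2)) ⟩
      (a1 * a2 + 2 * (c + a2) + 1) + 2 * a1 + 2 * F
        ≡⟨ ring₂ (a1 * a2) c a1 a2 F ⟩
      2 * F + 2 * c + a1 * a2 + a1 + a2 + 1 + (a1 + a2) ∎)
      where
      open ≡-Reasoning
      h F : ℕ
      h = floorSum (c + a2)
      F = count₂ c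
      ring₁ : ∀ h a1 a2 F → 2 * (h + a1 + F) + (a1 + a2) ≡ (2 * h + a1 + a2) + 2 * a1 + 2 * F
      ring₁ = solve 4 (λ h a1 a2 F → con 2 :* (h :+ a1 :+ F) :+ (a1 :+ a2) := (con 2 :* h :+ a1 :+ a2) :+ con 2 :* a1 :+ con 2 :* F) refl
      ring₂ : ∀ m c a1 a2 F → (m + 2 * (c + a2) + 1) + 2 * a1 + 2 * F ≡ 2 * F + 2 * c + m + a1 + a2 + 1 + (a1 + a2)
      ring₂ = solve 5 (λ m c a1 a2 F → (m :+ con 2 :* (c :+ a2) :+ con 1) :+ con 2 :* a1 :+ con 2 :* F
          := con 2 :* F :+ con 2 :* c :+ m :+ a1 :+ a2 :+ con 1 :+ (a1 :+ a2)) refl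

    double-count₂-+q*m : ∀ r q → 2 * count₂ (r + q * (a1 * a2)) ≡ 2 * count₂ r + a1 * a2 * (q * q) + q * (2 * r + a1 + a2 + 1)
    double-count₂-+q*m r zero = begin
      2 * count₂ (r + 0)                 ≡⟨ cong (λ c → 2 * count₂ c) (+-identityʳ r) ⟩
      2 * count₂ r                       ≡⟨ ring (count₂ r) (a1 * a2) (2 * r + a1 + a2 + 1) ⟩
      2 * count₂ r + a1 * a2 * 0 + 0     ∎
      where
      open ≡-Reasoning
      ring : ∀ F m s → 2 * F ≡ 2 * F + m * 0 + 0 * s
      ring = solve 3 (λ F m s → con 2 :* F := con 2 :* F :+ m :* con 0 :+ con 0 :* s) refl
    double-count₂-+q*m r (suc q) = begin
      2 * count₂ (r + suc q * m)                                  ≡⟨ cong (λ c → 2 * count₂ c) (ring₁ r q m) ⟩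
      2 * count₂ (r + q * m + m)                                  ≡⟨ double-count₂-+ (r + q * m) ⟩
      2 * count₂ (r + q * m) + 2 * (r + q * m) + m + a1 + a2 + 1  ≡⟨ cong (λ k → k + 2 * (r + q * m) + m + a1 + a2 + 1) (double-count₂-+q*m r q) ⟩
      2 * count₂ r + m * (q * q) + q * (2 * r + a1 + a2 + 1) + 2 * (r + q * m) + m + a1 + a2 + 1
                                                                  ≡⟨ ring₂ (count₂ r) m q r a1 a2 ⟩
      2 * count₂ r + m * (suc q * suc q) + suc q * (2 * r + a1 + a2 + 1) ∎
      where
      open ≡-Reasoning
      m : ℕ
      m = a1 * a2
      ring₁ : ∀ r q m → r + suc q * m ≡ r + q * m + m
      ring₁ = solve 3 (λ r q m → r :+ (con 1 :+ q) :* m := r :+ q :* m :+ m) refl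
      ring₂ : ∀ F m q r a1 a2 → 2 * F + m * (q * q) + q * (2 * r + a1 + a2 + 1) + 2 * (r + q * m) + m + a1 + a2 + 1
                              ≡ 2 * F + m * (suc q * suc q) + suc q * (2 * r + a1 + a2 + 1)
      ring₂ = solve 6 (λ F m q r a1 a2 → con 2 :* F :+ m :* (q :* q) :+ q :* (con 2 :* r :+ a1 :+ a2 :+ con 1) :+ con 2 :* (r :+ q :* m) :+ m :+ a1 :+ a2 :+ con 1
          := con 2 :* F :+ m :* ((con 1 :+ q) :* (con 1 :+ q)) :+ (con 1 :+ q) :* (con 2 :* r :+ a1 :+ a2 :+ con 1)) refl

    count₂-+q*m : ∀ r q → 2 * count₂ r + q * (a1 + a2 + 1 + 2 * (r + q * (a1 * a2)))
                        ≡ 2 * count₂ (r + q * (a1 * a2)) + a1 * a2 * (q * q)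
    count₂-+q*m r q = begin
      2 * count₂ r + q * (a1 + a2 + 1 + 2 * (r + q * m))
        ≡⟨ ring (count₂ r) m q r a1 a2 ⟩
      2 * count₂ r + m * (q * q) + q * (2 * r + a1 + a2 + 1) + m * (q * q)
        ≡⟨ cong (_+ m * (q * q)) (double-count₂-+q*m r q) ⟨
      2 * count₂ (r + q * m) + m * (q * q) ∎
      where
      open ≡-Reasoning
      m : ℕ
      m = a1 * a2
      ring : ∀ F m q r a1 a2 → 2 * F + q * (a1 + a2 + 1 + 2 * (r + q * m)) ≡ 2 * F + m * (q * q) + q * (2 * r + a1 + a2 + 1) + m * (q * q)
      ring = solve 6 (λ F m q r a1 a2 → con 2 :* F :+ q :* (a1 :+ a2 :+ con 1 :+ con 2 :* (r :+ q :* m))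
          := con 2 :* F :+ m :* (q :* q) :+ q :* (con 2 :* r :+ a1 :+ a2 :+ con 1) :+ m :* (q :* q)) refl

ℕ→ℚ≡mkℚ : ∀ n → ℕ→ℚ n ≡ mkℚ (ℤ.+ n) 0 (λ (_ , d∣1) → ∣1⇒≡1 d∣1)
ℕ→ℚ≡mkℚ n = normalize-coprime _

ℕ→ℚ-+ : ∀ m n → ℕ→ℚ (m + n) ≡ ℕ→ℚ m ℚ.+ ℕ→ℚ n
ℕ→ℚ-+ m n = sym (begin
  ℕ→ℚ m ℚ.+ ℕ→ℚ n                                   ≡⟨ cong₂ ℚ._+_ (ℕ→ℚ≡mkℚ m) (ℕ→ℚ≡mkℚ n) ⟩
  (ℤ.+ m ℤ.* ℤ.+ 1 ℤ.+ ℤ.+ n ℤ.* ℤ.+ 1) ℚ./ 1        ≡⟨ cong (ℚ._/ 1) (cong₂ ℤ._+_ (ℤ.*-identityʳ (ℤ.+ m)) (ℤ.*-identityʳ (ℤ.+ n))) ⟩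
  (ℤ.+ m ℤ.+ ℤ.+ n) ℚ./ 1                           ∎)
  where open ≡-Reasoning

ℕ→ℚ-* : ∀ m n → ℕ→ℚ (m * n) ≡ ℕ→ℚ m ℚ.* ℕ→ℚ n
ℕ→ℚ-* m n = sym (trans (cong₂ ℚ._*_ (ℕ→ℚ≡mkℚ m) (ℕ→ℚ≡mkℚ n)) (cong (ℚ._/ 1) (sym (ℤ.pos-* m n))))

+n/2≡ℕ→ℚn*½ : ∀ n → ℤ.+ n ℚ./ 2 ≡ ℕ→ℚ n ℚ.* ½
+n/2≡ℕ→ℚn*½ n = sym (trans (cong (ℚ._* ½) (ℕ→ℚ≡mkℚ n)) (cong (ℚ._/ 2) (ℤ.*-identityʳ (ℤ.+ n))))

ℕ→ℚ-sumℕ : ∀ n f → ℕ→ℚ (sumℕ n f) ≡ sumℚ n (λ i → ℕ→ℚ (f i))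
ℕ→ℚ-sumℕ zero    f = refl
ℕ→ℚ-sumℕ (suc n) f = trans (ℕ→ℚ-+ (sumℕ n f) (f (suc n))) (cong (ℚ._+ ℕ→ℚ (f (suc n))) (ℕ→ℚ-sumℕ n f))

sumℚ-cong : ∀ n {f g} → (∀ i → f i ≡ g i) → sumℚ n f ≡ sumℚ n g
sumℚ-cong zero    f≗g = f≗g 0
sumℚ-cong (suc n) f≗g = cong₂ ℚ._+_ (sumℚ-cong n f≗g) (f≗g (suc n))

-mq²/2+sq/2+R≡C : ∀ R C m q s → 2 * R + q * s ≡ 2 * C + m * (q * q) →
                  ℚ.- (ℕ→ℚ m ℚ.* ½) ℚ.* (ℕ→ℚ q ℚ.* ℕ→ℚ q) ℚ.+ (ℕ→ℚ s ℚ.* ½) ℚ.* ℕ→ℚ q ℚ.+ ℕ→ℚ R ≡ ℕ→ℚ C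
-mq²/2+sq/2+R≡C R C m q s 2R+qs≡2C+mq² = begin
  ℚ.- (M ℚ.* ½) ℚ.* (Q ℚ.* Q) ℚ.+ (S ℚ.* ½) ℚ.* Q ℚ.+ ℕ→ℚ R        ≡⟨ regroup (ℕ→ℚ R) M Q S ⟩
  ½ ℚ.* (two ℚ.* ℕ→ℚ R ℚ.+ Q ℚ.* S) ℚ.- ½ ℚ.* (M ℚ.* (Q ℚ.* Q))     ≡⟨ cong (λ x → ½ ℚ.* x ℚ.- ½ ℚ.* (M ℚ.* (Q ℚ.* Q))) doubled ⟩
  ½ ℚ.* (two ℚ.* ℕ→ℚ C ℚ.+ M ℚ.* (Q ℚ.* Q)) ℚ.- ½ ℚ.* (M ℚ.* (Q ℚ.* Q)) ≡⟨ halve (ℕ→ℚ C) M Q ⟩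
  ℕ→ℚ C                                                           ∎
  where
  open ≡-Reasoning
  open ℚ-Ring using () renaming (solve to solveℚ; con to κ; _:+_ to _⊕_; _:*_ to _⊛_; _:-_ to _⊖_; :-_ to ⊖_; _:=_ to _≐_)
  two M Q S : ℚ
  two = ℕ→ℚ 2
  M = ℕ→ℚ m
  Q = ℕ→ℚ q
  S = ℕ→ℚ s
  push : ∀ x y z → ℕ→ℚ (2 * x + y * z) ≡ two ℚ.* ℕ→ℚ x ℚ.+ ℕ→ℚ y ℚ.* ℕ→ℚ z
  push x y z = trans (ℕ→ℚ-+ (2 * x) (y * z)) (cong₂ ℚ._+_ (ℕ→ℚ-* 2 x) (ℕ→ℚ-* y z))
  doubled : two ℚ.* ℕ→ℚ R ℚ.+ Q ℚ.* S ≡ two ℚ.* ℕ→ℚ C ℚ.+ M ℚ.* (Q ℚ.* Q)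
  doubled = begin
    two ℚ.* ℕ→ℚ R ℚ.+ Q ℚ.* S                 ≡⟨ push R q s ⟨
    ℕ→ℚ (2 * R + q * s)                        ≡⟨ cong ℕ→ℚ 2R+qs≡2C+mq² ⟩
    ℕ→ℚ (2 * C + m * (q * q))                  ≡⟨ push C m (q * q) ⟩
    two ℚ.* ℕ→ℚ C ℚ.+ M ℚ.* ℕ→ℚ (q * q)       ≡⟨ cong (λ x → two ℚ.* ℕ→ℚ C ℚ.+ M ℚ.* x) (ℕ→ℚ-* q q) ⟩
    two ℚ.* ℕ→ℚ C ℚ.+ M ℚ.* (Q ℚ.* Q)         ∎
  regroup : ∀ R M Q S → ℚ.- (M ℚ.* ½) ℚ.* (Q ℚ.* Q) ℚ.+ (S ℚ.* ½) ℚ.* Q ℚ.+ R ≡ ½ ℚ.* (two ℚ.* R ℚ.+ Q ℚ.* S) ℚ.- ½ ℚ.* (M ℚ.* (Q ℚ.* Q))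
  regroup = solveℚ 4 (λ R M Q S → ⊖ (M ⊛ κ ½) ⊛ (Q ⊛ Q) ⊕ (S ⊛ κ ½) ⊛ Q ⊕ R ≐ κ ½ ⊛ (κ two ⊛ R ⊕ Q ⊛ S) ⊖ κ ½ ⊛ (M ⊛ (Q ⊛ Q))) refl
  halve : ∀ C M Q → ½ ℚ.* (two ℚ.* C ℚ.+ M ℚ.* (Q ℚ.* Q)) ℚ.- ½ ℚ.* (M ℚ.* (Q ℚ.* Q)) ≡ C
  halve = solveℚ 3 (λ C M Q → κ ½ ⊛ (κ two ⊛ C ⊕ M ⊛ (Q ⊛ Q)) ⊖ κ ½ ⊛ (M ⊛ (Q ⊛ Q)) ≐ C) refl

term≡count₂ : ∀ a1 a2 a3 b i .{{_ : NonZero a1}} .{{_ : NonZero a2}} → Coprime a1 a2 →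
              term a1 a2 a3 b i ≡ ℕ→ℚ (count₂ a1 a2 (b ∸ a3 * i))
term≡count₂ a1 a2 a3 b i coprime = begin
  term a1 a2 a3 b i
    ≡⟨ cong₂ (λ x y → ℚ.- x ℚ.* (Q ℚ.* Q) ℚ.+ y ℚ.* Q ℚ.+ ℕ→ℚ (count₂ a1 a2 r)) (+n/2≡ℕ→ℚn*½ m) (+n/2≡ℕ→ℚn*½ s) ⟩
  ℚ.- (ℕ→ℚ m ℚ.* ½) ℚ.* (Q ℚ.* Q) ℚ.+ (ℕ→ℚ s ℚ.* ½) ℚ.* Q ℚ.+ ℕ→ℚ (count₂ a1 a2 r)
    ≡⟨ -mq²/2+sq/2+R≡C (count₂ a1 a2 r) (count₂ a1 a2 c) m q s (subst (λ x → 2 * count₂ a1 a2 r + q * (a1 + a2 + 1 + 2 * x) ≡ 2 * count₂ a1 a2 x + m * (q * q))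
                              (sym (m≡m%n+[m/n]*n c m)) (count₂-+q*m a1 a2 coprime r q)) ⟩
  ℕ→ℚ (count₂ a1 a2 c) ∎
  where
  open ≡-Reasoning
  m c q r s : ℕ
  m = a1 * a2
  instance
    m≢0 : NonZero m
    m≢0 = m*n≢0 a1 a2
  c = b ∸ a3 * i
  q = c / m
  r = c % m
  s = a1 + a2 + 1 + 2 * c
  Q : ℚ
  Q = ℕ→ℚ q

module _ (a1 a2 a3 : ℕ) .{{_ : NonZero a1}} .{{_ : NonZero a2}} .{{_ : NonZero a3}} where

  Pts₃ : ℕ → Set
  Pts₃ b = Σ ℕ (λ x3 → x3 ≤ b / a3 × Pts₂ a1 a2 (b ∸ a3 * x3))

  Pts₃↔LatticePts : ∀ b → Pts₃ b ↔ LatticePts a1 a2 a3 b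
  Pts₃↔LatticePts b = mk↔ₛ′ to from to∘from from∘to
    where
    to : Pts₃ b → LatticePts a1 a2 a3 b
    to (x3 , x3≤ , x2 , x2≤ , x1 , x1≤) = (x1 , x2 , x3) , (begin
      a1 * x1 + a2 * x2 + a3 * x3  ≡⟨ cong₂ (λ u v → u + v + a3 * x3) (*-comm a1 x1) (*-comm a2 x2) ⟩
      x1 * a1 + x2 * a2 + a3 * x3  ≤⟨ m≤o∸n⇒m+n≤o _ (subst (_≤ b) (*-comm x3 a3) (m≤n/o⇒m*o≤n a3 x3≤))
                                        (m≤o∸n⇒m+n≤o _ (m≤n/o⇒m*o≤n a2 x2≤) (m≤n/o⇒m*o≤n a1 x1≤)) ⟩
      b                            ∎)
      where open ≤-Reasoning
    from : LatticePts a1 a2 a3 b → Pts₃ b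
    from ((x1 , x2 , x3) , ≤b) = x3 , x3≤ , x2 , x2≤ , x1 , x1≤
      where
      ≤b-a3x3 : a1 * x1 + a2 * x2 ≤ b ∸ a3 * x3
      ≤b-a3x3 = m+n≤o⇒m≤o∸n _ ≤b
      x3≤ : x3 ≤ b / a3
      x3≤ = m*o≤n⇒m≤n/o a3 (subst (_≤ b) (*-comm a3 x3) (m+n≤o⇒n≤o _ ≤b))
      x2≤ : x2 ≤ (b ∸ a3 * x3) / a2
      x2≤ = m*o≤n⇒m≤n/o a2 (subst (_≤ b ∸ a3 * x3) (*-comm a2 x2) (m+n≤o⇒n≤o _ ≤b-a3x3))
      x1≤ : x1 ≤ (b ∸ a3 * x3 ∸ x2 * a2) / a1
      x1≤ = m*o≤n⇒m≤n/o a1 (subst₂ (λ u v → u ≤ b ∸ a3 * x3 ∸ v) (*-comm a1 x1) (*-comm a2 x2) (m+n≤o⇒m≤o∸n _ ≤b-a3x3))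
    to∘from : ∀ y → to (from y) ≡ y
    to∘from (x , _) = cong (x ,_) (≤-irrelevant _ _)
    from∘to : ∀ x → from (to x) ≡ x
    from∘to (x3 , x3≤ , x2 , x2≤ , x1 , x1≤) = bounds-≡ (≤-irrelevant _ _) (≤-irrelevant _ _) (≤-irrelevant _ _)
      where
      bounds-≡ : ∀ {p3 p2 p1} → p3 ≡ x3≤ → p2 ≡ x2≤ → p1 ≡ x1≤ → (x3 , p3 , x2 , p2 , x1 , p1) ≡ (x3 , x3≤ , x2 , x2≤ , x1 , x1≤)
      bounds-≡ refl refl refl = refl

  Fin-sum-count₂↔Pts₃ : ∀ b → Fin (sumℕ (b / a3) (λ x3 → count₂ a1 a2 (b ∸ a3 * x3))) ↔ Pts₃ b
  Fin-sum-count₂↔Pts₃ b = Fin-sumℕ↔Σ≤ (λ x3 → Pts₂ a1 a2 (b ∸ a3 * x3)) _ (λ x3 → Fin-count₂↔Pts₂ a1 a2 (b ∸ a3 * x3)) (b / a3)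

theorem5p1 : (a1 a2 a3 b : ℕ) → .{{_ : NonZero a1}} → .{{_ : NonZero a2}} → .{{_ : NonZero a3}}
    → a1 < a2 → a2 < a3 → Coprime a1 a2
    → Σ ℕ (λ N → (Fin N ↔ LatticePts a1 a2 a3 b) × (ℕ→ℚ N ≡ countFormula a1 a2 a3 b))
theorem5p1 a1 a2 a3 b _ _ coprime = N , Fin↔LatticePts , N≡countFormula
  where
  N : ℕ
  N = sumℕ (b / a3) (λ i → count₂ a1 a2 (b ∸ a3 * i))
  Fin↔LatticePts : Fin N ↔ LatticePts a1 a2 a3 b
  Fin↔LatticePts = ↔-trans (Fin-sum-count₂↔Pts₃ a1 a2 a3 b) (Pts₃↔LatticePts a1 a2 a3 b)
  N≡countFormula : ℕ→ℚ N ≡ countFormula a1 a2 a3 b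
  N≡countFormula = trans (ℕ→ℚ-sumℕ (b / a3) _) (sumℚ-cong (b / a3) (λ i → sym (term≡count₂ a1 a2 a3 b i coprime)))
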